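{- Let $m\ge 4$ and let $n\ge 5$ be odd. On an $m\times n$ board with White king on $(m,1)$, White rook on $(1,1)$, Black king (alone) on $(m,n)$, and White to move, White can force checkmate in at most $n$ moves against every defence by Black.
   Context: The board consists of the squares $(i,j)$ with $1\le i\le m$ (column index) and $1\le j\le n$ (row index). Pieces move according to the usual chess rules adapted to this board: a king moves to any adjacent square, a rook moves any number of squares along its row or column without passing over other pieces, kings may not move into check, and the two kings may never be on adjacent squares. The number of moves counted is the number of White moves, including the mating move. -}

module Defs where

open import Data.Nat using (ℕ; zero; suc; _≤_; _<_; ∣_-_∣)
open import Data.Product using (_×_; _,_; ∃; Σ)
open import Data.Sum using (_⊎_)
open import Data.Maybe using (Maybe; just; nothing)
open import Data.Empty using (⊥)
open import Relation.Nullary using (¬_)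
open import Relation.Binary.PropositionalEquality using (_≡_; _≢_)

Square : Set
Square = ℕ × ℕ

col : Square → ℕ
col (i , _) = i

row : Square → ℕ
row (_ , j) = j

OnBoard : ℕ → ℕ → Square → Set
OnBoard m n (i , j) = (1 ≤ i × i ≤ m) × (1 ≤ j × j ≤ n)

Adj : Square → Square → Set
Adj s t = s ≢ t × (∣ col s - col t ∣ ≤ 1 × ∣ row s - row t ∣ ≤ 1)

Apart : Square → Square → Set
Apart s t = 2 ≤ ∣ col s - col t ∣ ⊎ 2 ≤ ∣ row s - row t ∣

StrictBetw : ℕ → ℕ → ℕ → Set
StrictBetw a b x = (a < x × x < b) ⊎ (b < x × x < a)

Between : Square → Square → Square → Set
Between r s b =
  (row r ≡ row s × row b ≡ row r × StrictBetw (col r) (col s) (col b))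
  ⊎ (col r ≡ col s × col b ≡ col r × StrictBetw (row r) (row s) (row b))

RookLine : Square → Square → Set
RookLine r s = r ≢ s × (col r ≡ col s ⊎ row r ≡ row s)

-- a rook on r attacks s, the only possible blocker being the white king wk
-- (the black king never shields a square from the rook it is fleeing)
RookAttacks : Square → Square → Square → Set
RookAttacks r wk s = RookLine r s × ¬ Between r s wk

-- A position: white king, white rook (nothing = captured), black king.
record Pos : Set where
  constructor pos
  field
    wk : Square
    wr : Maybe Square
    bk : Square

module Game (m n : ℕ) where

  data WhiteMove : Pos → Pos → Set where
    kingMove : ∀ {k r b k′} → OnBoard m n k′ → Adj k k′ → just k′ ≢ r → Apart k′ b →
               WhiteMove (pos k r b) (pos k′ r b)
    rookMove : ∀ {k r b r′} → OnBoard m n r′ → RookLine r r′ →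
               ¬ Between r r′ k → ¬ Between r r′ b → r′ ≢ k → r′ ≢ b →
               WhiteMove (pos k (just r) b) (pos k (just r′) b)

  data BlackMove : Pos → Pos → Set where
    noRook  : ∀ {k b b′} → OnBoard m n b′ → Adj b b′ → Apart k b′ →
              BlackMove (pos k nothing b) (pos k nothing b′)
    quiet   : ∀ {k r b b′} → OnBoard m n b′ → Adj b b′ → Apart k b′ →
              b′ ≢ r → ¬ RookAttacks r k b′ →
              BlackMove (pos k (just r) b) (pos k (just r) b′)
    capture : ∀ {k r b} → OnBoard m n r → Adj b r → Apart k r →
              BlackMove (pos k (just r) b) (pos k nothing r)

  InCheck : Pos → Set
  InCheck (pos k nothing b) = ⊥
  InCheck (pos k (just r) b) = RookAttacks r k b

  Checkmate : Pos → Set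
  Checkmate p = InCheck p × (∀ q → ¬ BlackMove p q)

  -- White (to move in p) can force checkmate within k White moves
  -- against every defence (stalemate is not a win)
  MateIn : ℕ → Pos → Set
  MateIn zero p = ⊥
  MateIn (suc k) p =
    Σ Pos λ p′ → WhiteMove p p′ ×
      (Checkmate p′ ⊎ ((∃ λ q → BlackMove p′ q) × (∀ q → BlackMove p′ q → MateIn k q)))

{-# OPTIONS --safe #-}
-- The rook's first move to column m - 1 fences the Black king into the edge column m for the
-- rest of the game, while the White king climbs that column one row per move. Before each White
-- move the kings are an odd number (at least 3) of rows apart, so the Black king, oscillating
-- along the edge, can never take the opposition and is pushed to the top row. When the White
-- king reaches row n - 3 it steps diagonally into column m - 1; this shields (m - 1, n) from the
-- rook and leaves the Black king no other square. The rook then swings to column m - 2, which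
-- drives the king back to the corner, and mates along the top row. One rook move, n - 4 king
-- steps and these three moves make n.
module Submission where

open import Defs
open import Data.Nat using (ℕ; zero; suc; _+_; _≤_; _<_; _≰_; _%_; z≤n; s≤s; ∣_-_∣)
open import Data.Nat.Properties
  using (1+n≢n; 1+n≰n; <⇒≢; <⇒≱; n≤1+n; m≤n+m; ≤-refl; ≤-trans; +-suc; +-comm)
open import Data.Product using (_,_; proj₁; proj₂; ∃; ∃-syntax)
open import Data.Sum using (inj₁; inj₂)
open import Data.Maybe using (just)
open import Data.Maybe.Properties using (just-injective)
open import Data.Empty using (⊥-elim)
open import Function using (_∘_)
open import Relation.Nullary using (¬_)
open import Relation.Binary.PropositionalEquality
  using (_≡_; _≢_; refl; sym; trans; cong; subst; ≢-sym)

data Near : ℕ → ℕ → Set where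
  same : ∀ {a} → Near a a
  inc  : ∀ {a} → Near a (suc a)
  dec  : ∀ {a} → Near (suc a) a

near : ∀ a b → ∣ a - b ∣ ≤ 1 → Near a b
near zero          zero          _       = same
near zero          (suc zero)    _       = inc
near zero          (suc (suc _)) (s≤s ())
near (suc zero)    zero          _       = dec
near (suc (suc _)) zero          (s≤s ())
near (suc a)       (suc b)       h with near a b h
... | same = same
... | inc  = inc
... | dec  = dec

Near⇒∣-∣≤1 : ∀ {a b} → Near a b → ∣ a - b ∣ ≤ 1
Near⇒∣-∣≤1 (same {zero})  = z≤n
Near⇒∣-∣≤1 (same {suc a}) = Near⇒∣-∣≤1 (same {a})
Near⇒∣-∣≤1 (inc {zero})   = ≤-refl
Near⇒∣-∣≤1 (inc {suc a})  = Near⇒∣-∣≤1 (inc {a})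
Near⇒∣-∣≤1 (dec {zero})   = ≤-refl
Near⇒∣-∣≤1 (dec {suc a})  = Near⇒∣-∣≤1 (dec {a})

Near⇒∣-∣≱2 : ∀ {a b} → Near a b → ¬ 2 ≤ ∣ a - b ∣
Near⇒∣-∣≱2 n 2≤ = <⇒≱ 2≤ (Near⇒∣-∣≤1 n)

2+m≤n⇒2≤∣m-n∣ : ∀ m {n} → 2 + m ≤ n → 2 ≤ ∣ m - n ∣
2+m≤n⇒2≤∣m-n∣ zero    h       = h
2+m≤n⇒2≤∣m-n∣ (suc m) (s≤s h) = 2+m≤n⇒2≤∣m-n∣ m h

3≤n⇒∣n-1∣≰1 : ∀ {n} → 3 ≤ n → ∣ n - 1 ∣ ≰ 1
3≤n⇒∣n-1∣≰1 (s≤s (s≤s (s≤s _))) (s≤s ())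

5+k-odd⇒k≡g+g : ∀ k → (5 + k) % 2 ≡ 1 → ∃[ g ] k ≡ g + g
5+k-odd⇒k≡g+g zero          _ = 0 , refl
5+k-odd⇒k≡g+g (suc zero)    ()
5+k-odd⇒k≡g+g (suc (suc k)) odd with 5+k-odd⇒k≡g+g k odd
... | g , refl = suc g , cong suc (sym (+-suc g g))

retreat-keeps-gap-odd : ∀ g w → 2 ≤ ∣ suc w - (2 + (g + g) + w) ∣ →
                        ∃[ g′ ] 2 + (g + g) + w ≡ 3 + (g′ + g′) + suc w
retreat-keeps-gap-odd zero    w gap = ⊥-elim (Near⇒∣-∣≱2 (inc {suc w}) gap)
retreat-keeps-gap-odd (suc g) w _   =
  g , cong (3 +_) (trans (cong (_+ w) (+-suc g g)) (sym (+-suc (g + g) w)))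

adjacent : ∀ {a b c d} → Near a b → Near c d → (a , c) ≢ (b , d) → Adj (a , c) (b , d)
adjacent nab ncd moved = moved , Near⇒∣-∣≤1 nab , Near⇒∣-∣≤1 ncd

Near⇒¬Apart : ∀ {a b c d} → Near a b → Near c d → ¬ Apart (a , c) (b , d)
Near⇒¬Apart nab _   (inj₁ 2≤) = Near⇒∣-∣≱2 nab 2≤
Near⇒¬Apart _   ncd (inj₂ 2≤) = Near⇒∣-∣≱2 ncd 2≤

Apart-column⇒2≤∣-∣ : ∀ {i a b} → Apart (i , a) (i , b) → 2 ≤ ∣ a - b ∣
Apart-column⇒2≤∣-∣ {i} (inj₁ 2≤) = ⊥-elim (Near⇒∣-∣≱2 (same {i}) 2≤)
Apart-column⇒2≤∣-∣ (inj₂ 2≤) = 2≤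

¬Between-row : ∀ {i₁ i₂ j k} → i₁ ≢ i₂ → row k ≢ j → ¬ Between (i₁ , j) (i₂ , j) k
¬Between-row _   k∉j (inj₁ (_ , e , _)) = k∉j e
¬Between-row i₁≢ _   (inj₂ (e , _ , _)) = i₁≢ e

¬Between-column : ∀ {i j₁ j₂ k} → j₁ ≢ j₂ → col k ≢ i → ¬ Between (i , j₁) (i , j₂) k
¬Between-column j₁≢ _   (inj₁ (e , _ , _)) = j₁≢ e
¬Between-column _   k∉i (inj₂ (_ , e , _)) = k∉i e

row-attack : ∀ {i₁ i₂ j k} → i₁ ≢ i₂ → row k ≢ j → RookAttacks (i₁ , j) k (i₂ , j)
row-attack i₁≢ k∉j = (i₁≢ ∘ cong proj₁ , inj₂ refl) , ¬Between-row i₁≢ k∉j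

column-attack : ∀ {i j₁ j₂ k} → j₁ ≢ j₂ → col k ≢ i → RookAttacks (i , j₁) k (i , j₂)
column-attack j₁≢ k∉i = (j₁≢ ∘ cong proj₂ , inj₁ refl) , ¬Between-column j₁≢ k∉i

¬RookAttacks-off-lines : ∀ {i₁ i₂ j₁ j₂ k} → i₁ ≢ i₂ → j₁ ≢ j₂ →
                         ¬ RookAttacks (i₁ , j₁) k (i₂ , j₂)
¬RookAttacks-off-lines i₁≢ _   ((_ , inj₁ e) , _) = i₁≢ e
¬RookAttacks-off-lines _   j₁≢ ((_ , inj₂ e) , _) = j₁≢ e

module _ {m n : ℕ} where
  open Game m n

  mate-by : ∀ {k p p′} → WhiteMove p p′ → Checkmate p′ → MateIn (suc k) p
  mate-by {p′ = p′} move mate = p′ , move , inj₁ mate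

  play : ∀ {k p p′} → WhiteMove p p′ → ∃ (BlackMove p′) →
         (∀ {q} → BlackMove p′ q → MateIn k q) → MateIn (suc k) p
  play {p′ = p′} move some-reply win = p′ , move , inj₂ (some-reply , λ _ → win)

  forcing : ∀ {k p p′ q} → WhiteMove p p′ → BlackMove p′ q →
            (∀ {q′} → BlackMove p′ q′ → q′ ≡ q) → MateIn k q → MateIn (suc k) p
  forcing {k} {q = q} move reply forced win =
    play move (q , reply) (λ reply′ → subst (MateIn k) (sym (forced reply′)) win)

module Mate (c n : ℕ) (1≤c : 1 ≤ c) where
  f m : ℕ
  f = suc c
  m = suc f

  open Game m n

  Corridor : ℕ → ℕ → Pos
  Corridor w b = pos (m , w) (just (f , 1)) (m , b)

  data CorridorReply (w : ℕ) : ℕ → Pos → Set where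
    up   : ∀ {b} → suc b ≤ n → CorridorReply w b (Corridor w (suc b))
    down : ∀ {b} → 2 ≤ ∣ w - b ∣ → CorridorReply w (suc b) (Corridor w b)

  corridor-reply : ∀ {w b q} → 3 ≤ b → BlackMove (Corridor w b) q → CorridorReply w b q
  corridor-reply 3≤b (capture _ (_ , _ , h) _) = ⊥-elim (3≤n⇒∣n-1∣≰1 3≤b h)
  corridor-reply {w} {b} 3≤b
    (quiet {b′ = i , j} ((_ , i≤m) , (_ , j≤n)) (moved , hi , hj) ap _ unattacked)
    with near m i hi | near b j hj
  ... | inc  | _    = ⊥-elim (1+n≰n i≤m)
  ... | dec  | _    = ⊥-elim (unattacked (column-attack 1≢j λ ()))
    where
      1≢j : 1 ≢ j
      1≢j refl = 3≤n⇒∣n-1∣≰1 3≤b hj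
  ... | same | same = ⊥-elim (moved refl)
  ... | same | inc  = up j≤n
  ... | same | dec  = down (Apart-column⇒2≤∣-∣ {m} {w} {j} ap)

  corridor-step : ∀ {w b b′} → Near b b′ → b ≢ b′ → 2 + w ≤ b′ → b′ ≤ n →
                  BlackMove (Corridor w b) (Corridor w b′)
  corridor-step {w} nb moved gap b′≤n =
    quiet ((s≤s z≤n , ≤-refl) , (≤-trans (s≤s z≤n) gap , b′≤n))
          (adjacent same nb (moved ∘ cong proj₂))
          (inj₂ (2+m≤n⇒2≤∣m-n∣ w gap))
          (λ ())
          (¬RookAttacks-off-lines (λ ()) (<⇒≢ (≤-trans (s≤s (s≤s z≤n)) gap)))

  king-climbs : ∀ {w b} → 3 + w ≤ b → b ≤ n → WhiteMove (Corridor w b) (Corridor (suc w) b)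
  king-climbs {w} gap b≤n =
    kingMove ((s≤s z≤n , ≤-refl) , (s≤s z≤n , ≤-trans (m≤n+m (suc w) 2) (≤-trans gap b≤n)))
             (adjacent same inc λ ())
             (λ ())
             (inj₂ (2+m≤n⇒2≤∣m-n∣ (suc w) gap))

  module TopRow (w : ℕ) (1≤w : 1 ≤ w) (n≡ : n ≡ 3 + w) where
    t : ℕ
    t = 3 + w

    P₁ P₂ P₃ P₄ P₅ : Pos
    P₁ = pos (f , suc w) (just (f , 1)) (m , t)
    P₂ = pos (f , suc w) (just (f , 1)) (f , t)
    P₃ = pos (f , suc w) (just (c , 1)) (f , t)
    P₄ = pos (f , suc w) (just (c , 1)) (m , t)
    P₅ = pos (f , suc w) (just (c , t)) (m , t)

    t≤n : t ≤ n
    t≤n = subst (t ≤_) (sym n≡) ≤-refl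

    ¬above-top : ¬ suc t ≤ n
    ¬above-top h = 1+n≰n (subst (suc t ≤_) n≡ h)

    1≢suc-w : 1 ≢ suc w
    1≢suc-w = <⇒≢ (s≤s 1≤w)

    c≤m : c ≤ m
    c≤m = ≤-trans (n≤1+n c) (n≤1+n f)

    kings-apart : ∀ i i′ → Apart (i , suc w) (i′ , t)
    kings-apart _ _ = inj₂ (2+m≤n⇒2≤∣m-n∣ (suc w) ≤-refl)

    white₁ : WhiteMove (Corridor w t) P₁
    white₁ = kingMove ((s≤s z≤n , n≤1+n f) , (s≤s z≤n , ≤-trans (m≤n+m (suc w) 2) t≤n))
                      (adjacent dec inc λ ())
                      (1≢suc-w ∘ sym ∘ cong proj₂ ∘ just-injective)
                      (kings-apart f m)

    black₁ : BlackMove P₁ P₂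
    black₁ = quiet ((s≤s z≤n , n≤1+n f) , (s≤s z≤n , t≤n)) (adjacent dec same λ ())
                   (kings-apart f f) (λ ()) shielded
      where
        shielded : ¬ RookAttacks (f , 1) (f , suc w) (f , t)
        shielded (_ , unblocked) = unblocked (inj₂ (refl , refl , inj₁ (s≤s 1≤w , n≤1+n _)))

    black₁-forced : ∀ {q} → BlackMove P₁ q → q ≡ P₂
    black₁-forced (capture _ (_ , _ , s≤s ()) _)
    black₁-forced (quiet {b′ = i , j} ((_ , i≤m) , (_ , j≤n)) (moved , hi , hj) ap _ _)
      with near m i hi | near t j hj
    ... | inc  | _    = ⊥-elim (1+n≰n i≤m)
    ... | _    | inc  = ⊥-elim (¬above-top j≤n)
    ... | same | same = ⊥-elim (moved refl)
    ... | same | dec  = ⊥-elim (Near⇒¬Apart (inc {f}) (inc {suc w}) ap)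
    ... | dec  | dec  = ⊥-elim (Near⇒¬Apart (same {f}) (inc {suc w}) ap)
    ... | dec  | same = refl

    white₂ : WhiteMove P₂ P₃
    white₂ = rookMove ((1≤c , c≤m) , (s≤s z≤n , ≤-trans (s≤s z≤n) t≤n)) ((λ ()) , inj₂ refl)
                      (¬Between-row (λ ()) (1≢suc-w ∘ sym)) (¬Between-row (λ ()) (λ ()))
                      (λ ()) (λ ())

    black₂ : BlackMove P₃ P₄
    black₂ = quiet ((s≤s z≤n , ≤-refl) , (s≤s z≤n , t≤n)) (adjacent inc same λ ())
                   (kings-apart f m) (λ ()) (¬RookAttacks-off-lines (λ ()) (λ ()))

    black₂-forced : ∀ {q} → BlackMove P₃ q → q ≡ P₄
    black₂-forced (capture _ (_ , _ , s≤s ()) _)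
    black₂-forced (quiet {b′ = i , j} (_ , (_ , j≤n)) (moved , hi , hj) ap _ unattacked)
      with near f i hi | near t j hj
    ... | _    | inc  = ⊥-elim (¬above-top j≤n)
    ... | ni   | dec  = ⊥-elim (Near⇒¬Apart ni (inc {suc w}) ap)
    ... | same | same = ⊥-elim (moved refl)
    ... | inc  | same = refl
    ... | dec  | same = ⊥-elim (unattacked (column-attack (λ ()) (λ ())))

    white₃ : WhiteMove P₄ P₅
    white₃ = rookMove ((1≤c , c≤m) , (s≤s z≤n , t≤n)) ((λ ()) , inj₁ refl)
                      (¬Between-column (λ ()) (λ ())) (¬Between-column (λ ()) (λ ()))
                      (λ ()) (λ ())

    P₅-checkmate : Checkmate P₅
    P₅-checkmate = row-attack (λ ()) (λ ()) , no-escape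
      where
        no-escape : ∀ q → ¬ BlackMove P₅ q
        no-escape _ (capture _ (_ , hi , _) _) with near m c hi
        ... | ()
        no-escape _ (quiet {b′ = i , j} ((_ , i≤m) , (_ , j≤n)) (moved , hi , hj) ap _ unattacked)
          with near m i hi | near t j hj
        ... | inc  | _    = 1+n≰n i≤m
        ... | _    | inc  = ¬above-top j≤n
        ... | same | same = moved refl
        ... | same | dec  = Near⇒¬Apart (inc {f}) (inc {suc w}) ap
        ... | dec  | dec  = Near⇒¬Apart (same {f}) (inc {suc w}) ap
        ... | dec  | same = unattacked (row-attack (λ ()) (λ ()))

    mate-in-3 : MateIn 3 (Corridor w t)
    mate-in-3 = forcing white₁ black₁ black₁-forced
                  (forcing white₂ black₂ black₂-forced
                    (mate-by white₃ P₅-checkmate))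

  -- s counts the rows the White king still has to climb; rows are written 3 + x + w so that
  -- the case s = g = 0 is definitionally the position of the finale.
  climb : ∀ s {w b g} → 1 ≤ w → n ≡ 3 + s + w → b ≡ 3 + (g + g) + w → b ≤ n →
          MateIn (3 + s) (Corridor w b)
  climb zero    {w} {g = zero}  1≤w n≡ refl _   = TopRow.mate-in-3 w 1≤w n≡
  climb zero    {w} {g = suc g} _   n≡ refl b≤n =
    ⊥-elim (1+n≰n (≤-trans (s≤s (s≤s (s≤s (s≤s (m≤n+m w (g + suc g))))))
                           (subst (3 + (suc g + suc g) + w ≤_) n≡ b≤n)))
  climb (suc s) {w} {g = g} _ n≡ refl b≤n =
    play (king-climbs (s≤s (s≤s (s≤s (m≤n+m w (g + g))))) b≤n)
         (some-reply g b≤n)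
         (continue ∘ corridor-reply (s≤s (s≤s (s≤s z≤n))))
    where
      n≡′ : n ≡ 3 + s + suc w
      n≡′ = trans n≡ (sym (cong (3 +_) (+-suc s w)))

      some-reply : ∀ k → 3 + (k + k) + w ≤ n → ∃ (BlackMove (Corridor (suc w) (3 + (k + k) + w)))
      some-reply zero    _   =
        _ , corridor-step inc (≢-sym 1+n≢n) (n≤1+n _)
                          (subst (4 + w ≤_) (sym n≡) (s≤s (s≤s (s≤s (s≤s (m≤n+m w s))))))
      some-reply (suc k) b≤n =
        _ , corridor-step dec 1+n≢n (s≤s (s≤s (s≤s (m≤n+m w (k + suc k))))) (≤-trans (n≤1+n _) b≤n)

      continue : ∀ {q} → CorridorReply (suc w) (3 + (g + g) + w) q → MateIn (3 + s) q
      continue (up b<n)  = climb s {g = g} (s≤s z≤n) n≡′ (sym (cong (3 +_) (+-suc (g + g) w))) b<n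
      continue (down gap) with retreat-keeps-gap-odd g w gap
      ... | g′ , b≡ = climb s {g = g′} (s≤s z≤n) n≡′ b≡ (≤-trans (n≤1+n _) b≤n)

module Start (c g : ℕ) (1≤c : 1 ≤ c) where
  n : ℕ
  n = 5 + (g + g)

  open Mate c n 1≤c
  open Game m n

  rook-to-fence : WhiteMove (pos (m , 1) (just (1 , 1)) (m , n)) (Corridor 1 n)
  rook-to-fence =
    rookMove ((s≤s z≤n , n≤1+n f) , (s≤s z≤n , s≤s z≤n)) (1≢f ∘ cong proj₁ , inj₂ refl)
             king-beyond (¬Between-row 1≢f λ ()) (λ ()) (λ ())
    where
      1≢f : 1 ≢ f
      1≢f = <⇒≢ (s≤s 1≤c)
      king-beyond : ¬ Between (1 , 1) (f , 1) (m , 1)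
      king-beyond (inj₁ (_ , _ , inj₁ (_ , m<f))) = 1+n≰n (≤-trans (n≤1+n m) m<f)
      king-beyond (inj₁ (_ , _ , inj₂ (_ , s≤s ())))
      king-beyond (inj₂ (1≡f , _ , _)) = 1≢f 1≡f

  mate-in-n : MateIn n (pos (m , 1) (just (1 , 1)) (m , n))
  mate-in-n =
    play rook-to-fence
         (_ , corridor-step dec 1+n≢n (s≤s (s≤s (s≤s z≤n))) (n≤1+n _))
         (continue ∘ corridor-reply (s≤s (s≤s (s≤s z≤n))))
    where
      continue : ∀ {q} → CorridorReply 1 n q → MateIn (4 + (g + g)) q
      continue (up n<n) = ⊥-elim (1+n≰n n<n)
      continue (down _) = climb (suc (g + g)) {g = g} ≤-refl
                                (cong (4 +_) (+-comm 1 (g + g)))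
                                (cong (3 +_) (+-comm 1 (g + g)))
                                (n≤1+n _)

lemma1 : (m n : ℕ) → 4 ≤ m → 5 ≤ n → n % 2 ≡ 1 →
    Game.MateIn m n n (pos (m , 1) (just (1 , 1)) (m , n))
lemma1 (suc (suc c)) (suc (suc (suc (suc (suc k))))) (s≤s (s≤s 2≤c))
       (s≤s (s≤s (s≤s (s≤s (s≤s _))))) odd
  with 5+k-odd⇒k≡g+g k odd
... | g , refl = Start.mate-in-n c g (≤-trans (s≤s z≤n) 2≤c)
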